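{- For all positive integers $k$ and $r$, $\chi_{la}(S_{k}\diamond \overline{K_{r}})=3$.
   Context: All graphs are finite and simple. For a graph $G$ with $m$ edges, a bijection $f:E(G)\to\{1,2,\dots,m\}$ is a local antimagic labeling if $\omega(u)\neq\omega(v)$ for every edge $uv$, where $\omega(u)=\sum_{e\in E(u)}f(e)$ and $E(u)$ is the set of edges incident with $u$. The local antimagic chromatic number $\chi_{la}(G)$ is the minimum number of distinct values of $\omega$ over all local antimagic labelings of $G$. The star $S_k$ has a center $c$ and $k$ leaves $v_1,\dots,v_k$. $\overline{K_r}$ is the edgeless graph on $r$ vertices. For graphs $G,H$, the edge-corona product $G\diamond H$ is obtained from one copy of $G$ and $|E(G)|$ disjoint copies of $H$, one assigned to each edge of $G$, by joining, for each edge $uv\in E(G)$, both $u$ and $v$ to every vertex of the copy of $H$ assigned to $uv$. Thus $S_k\diamond\overline{K_r}$ has vertices $c,v_i,u_i^j$ ($1\le i\le k$, $1\le j\le r$) and edges $cv_i, cu_i^j, v_iu_i^j$. -}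

module Defs where

open import Data.Nat using (ℕ; zero; suc; _+_; _≤_; _<_)
import Data.Nat as ℕ
open import Data.Fin using (Fin; toℕ)
import Data.Fin as Fin
open import Data.Bool using (Bool; if_then_else_)
open import Data.List using (List; []; _∷_; _++_; map; concat; concatMap; length; lookup; allFin; deduplicate)
open import Data.Nat.ListAction using (sum)
open import Data.Product using (_×_; _,_; Σ; ∃; ∃-syntax; proj₁; proj₂)
open import Data.Sum using (_⊎_; inj₁; inj₂)
import Data.Sum.Properties as SumP
import Data.Product.Properties as ProdP
open import Relation.Binary.Definitions using (DecidableEquality)
open import Relation.Binary.PropositionalEquality using (_≡_)
open import Relation.Nullary using (¬_; _⊎-dec_)
open import Relation.Nullary.Decidable using (⌊_⌋)
open import Function.Definitions using (Bijective)

-- A finite graph: a vertex type with decidable equality, an enumeration of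
-- all its vertices, and the list of its edges (unordered pairs, each listed once).
record Graph : Set₁ where
  field
    V        : Set
    _≟V_     : DecidableEquality V
    vertices : List V
    edges    : List (V × V)

  m : ℕ
  m = length edges

  edge : Fin m → V × V
  edge = lookup edges

open Graph public

-- an edge-labeling is a bijection E(G) → {1,…,m}; we represent it by a
-- bijection σ : Fin m → Fin m, the label of edge i being 1 + toℕ (σ i).
Labeling : Graph → Set
Labeling G = Σ (Fin (m G) → Fin (m G)) (Bijective _≡_ _≡_)

label : (G : Graph) → Labeling G → Fin (m G) → ℕ
label G (σ , _) i = suc (toℕ (σ i))

incident : (G : Graph) → V G → Fin (m G) → Bool
incident G u i = ⌊ (_≟V_ G u (proj₁ (edge G i))) ⊎-dec (_≟V_ G u (proj₂ (edge G i))) ⌋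

ω : (G : Graph) → Labeling G → V G → ℕ
ω G f u = sum (map (λ i → if incident G u i then label G f i else 0) (allFin (m G)))

IsLocalAntimagic : (G : Graph) → Labeling G → Set
IsLocalAntimagic G f = (i : Fin (m G)) → ¬ (ω G f (proj₁ (edge G i)) ≡ ω G f (proj₂ (edge G i)))

numColors : (G : Graph) → Labeling G → ℕ
numColors G f = length (deduplicate ℕ._≟_ (map (ω G f) (vertices G)))

χla≡ : Graph → ℕ → Set
χla≡ G c = (∃[ f ] (IsLocalAntimagic G f × numColors G f ≡ c))
         × ((f : Labeling G) → IsLocalAntimagic G f → c ≤ numColors G f)

-- the star S_k : vertex 0 is the center c, vertex (suc i) is the leaf v_{i+1}
Star : ℕ → Graph
Star k = record
  { V = Fin (suc k)
  ; _≟V_ = Fin._≟_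
  ; vertices = allFin (suc k)
  ; edges = map (λ i → (Fin.zero , Fin.suc i)) (allFin k)
  }

Empty : ℕ → Graph
Empty r = record { V = Fin r ; _≟V_ = Fin._≟_ ; vertices = allFin r ; edges = [] }

-- edge-corona product G ◇ H: vertices of G plus, for each edge i of G, a copy
-- (i , x) of each vertex x of H; edges: those of G, those of each copy of H,
-- and, for edge i = uv of G, uy and vy for every vertex y of copy i.
_◇_ : Graph → Graph → Graph
G ◇ H = record
  { V = V G ⊎ (Fin (m G) × V H)
  ; _≟V_ = SumP.≡-dec (_≟V_ G) (ProdP.≡-dec Fin._≟_ (_≟V_ H))
  ; vertices = map inj₁ (vertices G)
             ++ concatMap (λ i → map (λ x → inj₂ (i , x)) (vertices H)) (allFin (m G))
  ; edges = map (λ e → (inj₁ (proj₁ e) , inj₁ (proj₂ e))) (edges G)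
          ++ concatMap (λ i →
               map (λ e → (inj₂ (i , proj₁ e) , inj₂ (i , proj₂ e))) (edges H)
               ++ concatMap (λ y → (inj₁ (proj₁ (edge G i)) , inj₂ (i , y))
                                 ∷ (inj₁ (proj₂ (edge G i)) , inj₂ (i , y)) ∷ [])
                            (vertices H))
             (allFin (m G))
  }

-- Lower bound: c, v_1 and u_1^1 form a triangle, so they receive three distinct sums.
-- Upper bound: counting labels from 0, give v_i u_i^y a label x < 2rk and c u_i^y the mirrored label
-- 2rk - 1 - x, so that every u_i^y has sum 2rk + 1, and give the spokes c v_i the top k labels.
-- The labels x are laid out in rows y that alternately run forwards and backwards over the leaves,
-- which makes the sum at v_i independent of i (for even r one row uses the even labels of the middle
-- block instead).  The center, carrying every large label, then has the largest sum and the copies the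
-- smallest.

module Submission where

open import Defs
open import Data.Bool using (if_then_else_)
open import Data.Empty using (⊥-elim)
open import Data.Fin using (Fin; zero; suc; toℕ; fromℕ<; cast)
open import Data.Fin.Properties
  using (toℕ-fromℕ<; toℕ-injective; toℕ<n; toℕ-cast; cast-involutive; injective⇒≤)
  renaming (suc-injective to Fin-suc-injective)
open import Data.List
  using (List; []; _∷_; _++_; map; concat; concatMap; length; lookup; allFin; tabulate;
         applyUpTo; applyDownFrom; upTo; reverse; deduplicate)
open import Data.List.Properties
  using (map-cong; map-∘; map-++; map-id; map-tabulate; tabulate-lookup; length-map;
         length-tabulate; concatMap-cong; concatMap-map; concatMap-++; map-concatMap;
         map-upTo; map-applyUpTo; reverse-applyUpTo; length-upTo; ++-assoc)
open import Data.List.Membership.Propositional using (_∈_)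
open import Data.List.Membership.Propositional.Properties
  using (∈-map⁺; ∈-map⁻; ∈-upTo⁺; ∈-upTo⁻; ∈-applyUpTo⁺; ∈-lookup; ∈-concat⁺′;
         ∈-deduplicate⁺; ∈-deduplicate⁻; ∈-++⁺ˡ; ∈-++⁺ʳ)
open import Data.List.Relation.Binary.Subset.Propositional using (_⊆_)
open import Data.List.Relation.Binary.Permutation.Propositional
  using (_↭_; ↭-refl; ↭-sym; ↭-trans; ↭-reflexive; ↭⇒↭ₛ; module PermutationReasoning)
open import Data.List.Relation.Binary.Permutation.Propositional.Properties
  using (∈-resp-↭; ↭-length; ++⁺ˡ; ++-comm; shifts; ↭-reverse)
  renaming (++⁺ to ++-↭; map⁺ to map-↭)
import Data.List.Relation.Binary.Permutation.Setoid.Properties as Permutationₛ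
open import Data.List.Relation.Unary.All using (All; []; _∷_; universal)
import Data.List.Relation.Unary.All as All
import Data.List.Relation.Unary.All.Properties as All
open import Data.List.Relation.Unary.Any using (here; there; index)
open import Data.List.Relation.Unary.Any.Properties using (lookup-index)
open import Data.List.Relation.Unary.Unique.Propositional using (Unique; []; _∷_)
open import Data.List.Relation.Unary.Unique.Propositional.Properties using (upTo⁺)
open import Data.List.Relation.Unary.Unique.DecPropositional.Properties using (deduplicate-!)
open import Data.Nat using (ℕ; zero; suc; _+_; _*_; _∸_; _≤_; _<_; _≟_; z≤n; z<s; s<s)
open import Data.Nat.ListAction using (sum)
open import Data.Nat.ListAction.Properties using (sum-++)
open import Data.Nat.Properties
open import Data.Nat.Tactic.RingSolver using (solve-∀)
open import Algebra.Properties.CommutativeSemigroup +-commutativeSemigroup using (interchange)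
open import Data.Product using (_×_; _,_; proj₁; proj₂)
open import Data.Sum using (inj₁; inj₂)
open import Data.Sum.Properties using (inj₁-injective; inj₂-injective)
open import Function using (_∘_; id)
open import Function.Definitions using (Injective; Surjective)
open import Relation.Binary.PropositionalEquality
  using (_≡_; _≢_; refl; sym; trans; cong; cong₂; subst; setoid; module ≡-Reasoning)
open import Relation.Nullary using (yes; no; _⊎-dec_)
open import Relation.Nullary.Decidable using (⌊_⌋)

∑ : ℕ → (ℕ → ℕ) → ℕ
∑ n f = sum (applyUpTo f n)

syntax ∑ n (λ i → e) = ∑[ i < n ] e

mirror : ℕ → ℕ → ℕ
mirror n i = n ∸ suc i

module _ {A : Set} where

  map-allFin-suc : ∀ {n} (f : Fin (suc n) → A) → map f (tabulate suc) ≡ map (f ∘ suc) (allFin n)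
  map-allFin-suc f = trans (map-tabulate suc f) (sym (map-tabulate id (f ∘ suc)))

  map-toℕ-allFin : ∀ n (f : ℕ → A) → map (f ∘ toℕ) (allFin n) ≡ applyUpTo f n
  map-toℕ-allFin zero    f = refl
  map-toℕ-allFin (suc n) f = cong (f 0 ∷_) (trans (map-allFin-suc (f ∘ toℕ)) (map-toℕ-allFin n (f ∘ suc)))

  lookup-map-tabulate : ∀ {B : Set} {n} (f : B → A) (g : Fin n → B) i →
                        lookup (map f (tabulate g)) i ≡ f (g (cast (trans (length-map f (tabulate g)) (length-tabulate g)) i))
  lookup-map-tabulate {n = suc n} f g zero    = refl
  lookup-map-tabulate {n = suc n} f g (suc i) = lookup-map-tabulate f (g ∘ suc) i

  applyUpTo-cong : ∀ {f g : ℕ → A} n → (∀ {i} → i < n → f i ≡ g i) → applyUpTo f n ≡ applyUpTo g n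
  applyUpTo-cong zero    f≡g = refl
  applyUpTo-cong (suc n) f≡g = cong₂ _∷_ (f≡g z<s) (applyUpTo-cong n (f≡g ∘ s<s))

  applyUpTo-+ : ∀ (f : ℕ → A) m n → applyUpTo f (m + n) ≡ applyUpTo f m ++ applyUpTo (λ i → f (m + i)) n
  applyUpTo-+ f zero    n = refl
  applyUpTo-+ f (suc m) n = cong (f 0 ∷_) (applyUpTo-+ (f ∘ suc) m n)

  applyUpTo-mirror : ∀ (f : ℕ → A) n → applyUpTo (f ∘ mirror n) n ≡ applyDownFrom f n
  applyUpTo-mirror f zero    = refl
  applyUpTo-mirror f (suc n) = cong (f n ∷_) (applyUpTo-mirror f n)

  concatMap-upTo-suc : ∀ (f : ℕ → List A) n → concatMap f (upTo (suc n)) ≡ f 0 ++ concatMap (f ∘ suc) (upTo n)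
  concatMap-upTo-suc f n = cong (λ xss → f 0 ++ concat xss) (trans (map-applyUpTo suc f n) (sym (map-upTo (f ∘ suc) n)))

  concatMap-concatMap : ∀ {B C : Set} (f : B → List C) (g : A → List B) xs →
                        concatMap f (concatMap g xs) ≡ concatMap (concatMap f ∘ g) xs
  concatMap-concatMap f g []       = refl
  concatMap-concatMap f g (x ∷ xs) = trans (concatMap-++ f (g x) (concatMap g xs))
                                           (cong (concatMap f (g x) ++_) (concatMap-concatMap f g xs))

  open PermutationReasoning

  applyUpTo-mirror↭ : ∀ (f : ℕ → A) n → applyUpTo (f ∘ mirror n) n ↭ applyUpTo f n
  applyUpTo-mirror↭ f n = begin
    applyUpTo (f ∘ mirror n) n  ≡⟨ applyUpTo-mirror f n ⟩
    applyDownFrom f n           ≡⟨ reverse-applyUpTo f n ⟨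
    reverse (applyUpTo f n)     ↭⟨ ↭-reverse (applyUpTo f n) ⟩
    applyUpTo f n               ∎

  applyUpTo-evens-odds↭ : ∀ (f : ℕ → A) n →
                          applyUpTo (λ i → f (i + i)) n ++ applyUpTo (λ i → f (suc (i + i))) n ↭ applyUpTo f (n + n)
  applyUpTo-evens-odds↭ f zero    = ↭-refl
  applyUpTo-evens-odds↭ f (suc n) = begin
    f 0 ∷ evens ++ f 1 ∷ odds          ↭⟨ ++⁺ˡ (f 0 ∷ []) (shifts evens (f 1 ∷ [])) ⟩
    f 0 ∷ f 1 ∷ evens ++ odds          ≡⟨ cong (λ xs → f 0 ∷ f 1 ∷ xs) (cong₂ _++_ shift-evens shift-odds) ⟩
    f 0 ∷ f 1 ∷ (applyUpTo (λ i → g (i + i)) n ++ applyUpTo (λ i → g (suc (i + i))) n)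
                                       ↭⟨ ++⁺ˡ (f 0 ∷ f 1 ∷ []) (applyUpTo-evens-odds↭ g n) ⟩
    f 0 ∷ f 1 ∷ applyUpTo g (n + n)    ≡⟨ cong (λ m → f 0 ∷ applyUpTo (f ∘ suc) m) (+-suc n n) ⟨
    applyUpTo f (suc n + suc n)        ∎
    where
    g = λ i → f (suc (suc i))
    evens = applyUpTo (λ i → f (suc i + suc i)) n
    odds  = applyUpTo (λ i → f (suc (suc i + suc i))) n
    shift-evens : evens ≡ applyUpTo (λ i → g (i + i)) n
    shift-evens = applyUpTo-cong n (λ {i} _ → cong (λ j → f (suc j)) (+-suc i i))
    shift-odds : odds ≡ applyUpTo (λ i → g (suc (i + i))) n
    shift-odds = applyUpTo-cong n (λ {i} _ → cong (λ j → f (suc (suc j))) (+-suc i i))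

sum-map-toℕ-allFin : ∀ n (f : ℕ → ℕ) → sum (map (f ∘ toℕ) (allFin n)) ≡ ∑ n f
sum-map-toℕ-allFin n f = cong sum (map-toℕ-allFin n f)

concatMap-toℕ-allFin : ∀ {A : Set} n (f : ℕ → List A) → concatMap (f ∘ toℕ) (allFin n) ≡ concatMap f (upTo n)
concatMap-toℕ-allFin n f = cong concat (trans (map-toℕ-allFin n f) (sym (map-upTo f n)))

module _ {A B : Set} where

  open PermutationReasoning

  concatMap-↭ : ∀ {f g : A → List B} → (∀ x → f x ↭ g x) → ∀ xs → concatMap f xs ↭ concatMap g xs
  concatMap-↭ f↭g []       = ↭-refl
  concatMap-↭ f↭g (x ∷ xs) = ++-↭ (f↭g x) (concatMap-↭ f↭g xs)

  concatMap-pairs↭ : ∀ (f g : A → B) xs → concatMap (λ x → f x ∷ g x ∷ []) xs ↭ map f xs ++ map g xs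
  concatMap-pairs↭ f g []       = ↭-refl
  concatMap-pairs↭ f g (x ∷ xs) = begin
    f x ∷ g x ∷ concatMap (λ x → f x ∷ g x ∷ []) xs ↭⟨ ++⁺ˡ (f x ∷ g x ∷ []) (concatMap-pairs↭ f g xs) ⟩
    f x ∷ g x ∷ map f xs ++ map g xs                 ↭⟨ ++⁺ˡ (f x ∷ []) (shifts (g x ∷ []) (map f xs)) ⟩
    f x ∷ map f xs ++ g x ∷ map g xs                 ∎

  map-++-concatMap↭ : ∀ (f : A → B) (g : A → List B) xs →
                      map f xs ++ concatMap g xs ↭ concatMap (λ x → f x ∷ g x) xs
  map-++-concatMap↭ f g []       = ↭-refl
  map-++-concatMap↭ f g (x ∷ xs) = begin
    f x ∷ map f xs ++ g x ++ concatMap g xs    ↭⟨ ++⁺ˡ (f x ∷ []) (shifts (map f xs) (g x)) ⟩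
    f x ∷ g x ++ map f xs ++ concatMap g xs    ↭⟨ ++⁺ˡ (f x ∷ g x) (map-++-concatMap↭ f g xs) ⟩
    f x ∷ g x ++ concatMap (λ x → f x ∷ g x) xs ∎

module _ {A B C : Set} where

  open PermutationReasoning

  concatMap-transpose↭ : ∀ (f : A → B → C) xs ys →
                         concatMap (λ x → map (f x) ys) xs ↭ concatMap (λ y → map (λ x → f x y) xs) ys
  concatMap-transpose↭ f []       ys = ↭-reflexive (sym (empty ys))
    where
    empty : ∀ ys → concatMap (λ _ → []) ys ≡ []
    empty []       = refl
    empty (_ ∷ ys) = empty ys
  concatMap-transpose↭ f (x ∷ xs) ys = begin
    map (f x) ys ++ concatMap (λ x → map (f x) ys) xs
      ↭⟨ ++⁺ˡ (map (f x) ys) (concatMap-transpose↭ f xs ys) ⟩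
    map (f x) ys ++ concatMap (λ y → map (λ x → f x y) xs) ys
      ↭⟨ map-++-concatMap↭ (f x) (λ y → map (λ x → f x y) xs) ys ⟩
    concatMap (λ y → map (λ x → f x y) (x ∷ xs)) ys ∎

mirror< : ∀ {n i} → i < n → mirror n i < n
mirror< i<n = ∸-monoʳ-< z<s i<n

suc+mirror : ∀ {n i} → i < n → suc i + mirror n i ≡ n
suc+mirror = m+[n∸m]≡n

suc-mirror+suc : ∀ {n i} → i < n → suc (mirror n i) + suc i ≡ suc n
suc-mirror+suc i<n = cong suc (m∸n+n≡m i<n)

mirror-unique : ∀ {n i j} → suc i + j ≡ n → mirror n i ≡ j
mirror-unique {i = i} {j} refl = m+n∸m≡n (suc i) j

<-mirror-double : ∀ {n i} → i < n → i < mirror (n + n) i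
<-mirror-double {n} {i} i<n = <-≤-trans i<n (subst (_≤ mirror (n + n) i) (m+n∸n≡m n n) (∸-monoʳ-≤ (n + n) i<n))

map-mirror-upTo↭ : ∀ {p o n} → o + p ≡ n → map (mirror n) (upTo p) ↭ applyUpTo (o +_) p
map-mirror-upTo↭ {p} {o} {n} o+p≡n = begin
  map (mirror n) (upTo p)          ≡⟨ map-upTo (mirror n) p ⟩
  applyUpTo (mirror n) p           ≡⟨ applyUpTo-cong p shift ⟩
  applyUpTo ((o +_) ∘ mirror p) p  ↭⟨ applyUpTo-mirror↭ (o +_) p ⟩
  applyUpTo (o +_) p               ∎
  where
  open PermutationReasoning
  shift : ∀ {i} → i < p → mirror n i ≡ o + mirror p i
  shift {i} i<p = trans (cong (_∸ suc i) (sym o+p≡n)) (+-∸-assoc o i<p)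

map-mirror-window↭ : ∀ a K → let evens = applyUpTo (λ i → a + (i + i)) K in
                     evens ++ map (mirror (K + a + (K + a))) evens ↭ applyUpTo (a +_) (K + K)
map-mirror-window↭ a K = begin
  evens ++ map (mirror (K + a + (K + a))) evens
    ≡⟨ cong (evens ++_) (map-applyUpTo (λ i → a + (i + i)) (mirror (K + a + (K + a))) K) ⟩
  evens ++ applyUpTo (λ i → mirror (K + a + (K + a)) (a + (i + i))) K
    ≡⟨ cong (evens ++_) (applyUpTo-cong K mirror-even) ⟩
  evens ++ applyUpTo ((λ j → a + suc (j + j)) ∘ mirror K) K
    ↭⟨ ++⁺ˡ evens (applyUpTo-mirror↭ (λ j → a + suc (j + j)) K) ⟩
  evens ++ applyUpTo (λ j → a + suc (j + j)) K
    ↭⟨ applyUpTo-evens-odds↭ (a +_) K ⟩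
  applyUpTo (a +_) (K + K) ∎
  where
  open PermutationReasoning
  evens = applyUpTo (λ i → a + (i + i)) K
  identity : ∀ a i j → suc (a + (i + i)) + (a + suc (j + j)) ≡ suc i + j + a + (suc i + j + a)
  identity = solve-∀
  mirror-even : ∀ {i} → i < K → mirror (K + a + (K + a)) (a + (i + i)) ≡ a + suc (mirror K i + mirror K i)
  mirror-even {i} i<K = mirror-unique {i = a + (i + i)}
    (trans (identity a i (mirror K i)) (cong (λ n → n + a + (n + a)) (suc+mirror i<K)))

sum-map-zero : ∀ {A : Set} {f : A → ℕ} xs → (∀ x → f x ≡ 0) → sum (map f xs) ≡ 0
sum-map-zero []       f≡0 = refl
sum-map-zero (x ∷ xs) f≡0 = cong₂ _+_ (f≡0 x) (sum-map-zero xs f≡0)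

sum-map-allFin-single : ∀ {n} (f : Fin n → ℕ) a → (∀ i → i ≢ a → f i ≡ 0) → sum (map f (allFin n)) ≡ f a
sum-map-allFin-single {suc n} f zero f≡0 = begin
  f zero + sum (map f (tabulate suc))     ≡⟨ cong (λ xs → f zero + sum xs) (map-allFin-suc f) ⟩
  f zero + sum (map (f ∘ suc) (allFin n)) ≡⟨ cong (f zero +_) (sum-map-zero (allFin n) (λ i → f≡0 (suc i) λ ())) ⟩
  f zero + 0                              ≡⟨ +-identityʳ (f zero) ⟩
  f zero                                  ∎
  where open ≡-Reasoning
sum-map-allFin-single {suc n} f (suc a) f≡0 = begin
  f zero + sum (map f (tabulate suc))     ≡⟨ cong (λ xs → f zero + sum xs) (map-allFin-suc f) ⟩
  f zero + sum (map (f ∘ suc) (allFin n))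
    ≡⟨ cong₂ _+_ (f≡0 zero λ ()) (sum-map-allFin-single (f ∘ suc) a λ i i≢a → f≡0 (suc i) (i≢a ∘ Fin-suc-injective)) ⟩
  f (suc a)                               ∎
  where open ≡-Reasoning

sum-map-concatMap : ∀ {A B : Set} (f : B → ℕ) (g : A → List B) xs →
                    sum (map f (concatMap g xs)) ≡ sum (map (λ x → sum (map f (g x))) xs)
sum-map-concatMap f g []       = refl
sum-map-concatMap f g (x ∷ xs) = begin
  sum (map f (g x ++ concatMap g xs))              ≡⟨ cong sum (map-++ f (g x) (concatMap g xs)) ⟩
  sum (map f (g x) ++ map f (concatMap g xs))      ≡⟨ sum-++ (map f (g x)) (map f (concatMap g xs)) ⟩
  sum (map f (g x)) + sum (map f (concatMap g xs)) ≡⟨ cong (sum (map f (g x)) +_) (sum-map-concatMap f g xs) ⟩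
  sum (map f (g x)) + sum (map (λ x → sum (map f (g x))) xs) ∎
  where open ≡-Reasoning

sum-map-pairs : ∀ {A B : Set} (f : B → ℕ) (g h : A → B) xs →
                sum (map f (concatMap (λ x → g x ∷ h x ∷ []) xs)) ≡ sum (map (λ x → f (g x) + f (h x)) xs)
sum-map-pairs f g h []       = refl
sum-map-pairs f g h (x ∷ xs) = trans (sym (+-assoc (f (g x)) (f (h x)) _))
                                     (cong (f (g x) + f (h x) +_) (sum-map-pairs f g h xs))

∑-+ : ∀ n (f g : ℕ → ℕ) → ∑[ i < n ] (f i + g i) ≡ ∑ n f + ∑ n g
∑-+ zero    f g = refl
∑-+ (suc n) f g = trans (cong (f 0 + g 0 +_) (∑-+ n (f ∘ suc) (g ∘ suc)))
                        (interchange (f 0) (g 0) (∑ n (f ∘ suc)) (∑ n (g ∘ suc)))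

∑-mono-≤ : ∀ n {f g : ℕ → ℕ} → (∀ {i} → i < n → f i ≤ g i) → ∑ n f ≤ ∑ n g
∑-mono-≤ zero    f≤g = z≤n
∑-mono-≤ (suc n) f≤g = +-mono-≤ (f≤g z<s) (∑-mono-≤ n (f≤g ∘ s<s))

∑-mono-< : ∀ n {f g : ℕ → ℕ} → (∀ {i} → i < suc n → f i < g i) → ∑ (suc n) f < ∑ (suc n) g
∑-mono-< n f<g = +-mono-<-≤ (f<g z<s) (∑-mono-≤ n (<⇒≤ ∘ f<g ∘ s<s))

-- Labelings of an arbitrary graph

module _ {A B : Set} (ℓ : A → B) where

  map-lookup-injective : ∀ {xs} → Unique (map ℓ xs) → ∀ {a b} → ℓ (lookup xs a) ≡ ℓ (lookup xs b) → a ≡ b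
  map-lookup-injective {_ ∷ _} (_ ∷ _)   {zero}  {zero}  _  = refl
  map-lookup-injective {_ ∷ _} (x≢ ∷ _)  {zero}  {suc b} eq = ⊥-elim (All.lookup x≢ (∈-map⁺ ℓ (∈-lookup b)) eq)
  map-lookup-injective {_ ∷ _} (x≢ ∷ _)  {suc a} {zero}  eq = ⊥-elim (All.lookup x≢ (∈-map⁺ ℓ (∈-lookup a)) (sym eq))
  map-lookup-injective {_ ∷ _} (_ ∷ xs!) {suc a} {suc b} eq = cong suc (map-lookup-injective xs! eq)

Unique⇒length≤ : ∀ {A : Set} {xs ys : List A} → Unique xs → xs ⊆ ys → length xs ≤ length ys
Unique⇒length≤ {xs = xs} {ys} xs! xs⊆ys = injective⇒≤ position-injective
  where
  position : Fin (length xs) → Fin (length ys)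
  position t = index (xs⊆ys (∈-lookup t))
  position-injective : Injective _≡_ _≡_ position
  position-injective {a} {b} eq = map-lookup-injective id (subst Unique (sym (map-id xs)) xs!) (begin
    lookup xs a            ≡⟨ lookup-index (xs⊆ys (∈-lookup a)) ⟩
    lookup ys (position a) ≡⟨ cong (lookup ys) eq ⟩
    lookup ys (position b) ≡⟨ lookup-index (xs⊆ys (∈-lookup b)) ⟨
    lookup xs b            ∎)
    where open ≡-Reasoning

module Relabeling {A : Set} (xs : List A) (ℓ : A → ℕ) (ℓ↭ : map ℓ xs ↭ upTo (length xs)) where

  relabel : Fin (length xs) → Fin (length xs)
  relabel t = fromℕ< (∈-upTo⁻ (∈-resp-↭ ℓ↭ (∈-map⁺ ℓ (∈-lookup t))))

  toℕ-relabel : ∀ t → toℕ (relabel t) ≡ ℓ (lookup xs t)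
  toℕ-relabel t = toℕ-fromℕ< _

  relabel-injective : Injective _≡_ _≡_ relabel
  relabel-injective {a} {b} eq = map-lookup-injective ℓ ℓ! (begin
    ℓ (lookup xs a)  ≡⟨ toℕ-relabel a ⟨
    toℕ (relabel a)  ≡⟨ cong toℕ eq ⟩
    toℕ (relabel b)  ≡⟨ toℕ-relabel b ⟩
    ℓ (lookup xs b)  ∎)
    where
    open ≡-Reasoning
    ℓ! : Unique (map ℓ xs)
    ℓ! = Permutationₛ.Unique-resp-↭ (setoid ℕ) (↭⇒↭ₛ (↭-sym ℓ↭)) (upTo⁺ (length xs))

  relabel-surjective : Surjective _≡_ _≡_ relabel
  relabel-surjective s with ∈-map⁻ ℓ (∈-resp-↭ (↭-sym ℓ↭) (∈-upTo⁺ (toℕ<n s)))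
  ... | x , x∈xs , s≡ℓx = index x∈xs , λ { refl → toℕ-injective (begin
    toℕ (relabel (index x∈xs))   ≡⟨ toℕ-relabel (index x∈xs) ⟩
    ℓ (lookup xs (index x∈xs))   ≡⟨ cong ℓ (lookup-index x∈xs) ⟨
    ℓ x                          ≡⟨ s≡ℓx ⟨
    toℕ s                        ∎) }
    where open ≡-Reasoning

module _ (G : Graph) where

  weight : (V G × V G → ℕ) → V G → V G × V G → ℕ
  weight ℓ u e = if ⌊ (_≟V_ G u (proj₁ e)) ⊎-dec (_≟V_ G u (proj₂ e)) ⌋ then suc (ℓ e) else 0

  module _ (ℓ : V G × V G → ℕ) {u : V G} {e : V G × V G} where

    weight-fst : u ≡ proj₁ e → weight ℓ u e ≡ suc (ℓ e)
    weight-fst u≡ with _≟V_ G u (proj₁ e)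
    ... | yes _  = refl
    ... | no u≢  = ⊥-elim (u≢ u≡)

    weight-snd : u ≡ proj₂ e → weight ℓ u e ≡ suc (ℓ e)
    weight-snd u≡ with _≟V_ G u (proj₁ e) | _≟V_ G u (proj₂ e)
    ... | yes _ | _     = refl
    ... | no _  | yes _ = refl
    ... | no _  | no u≢ = ⊥-elim (u≢ u≡)

    weight-nonincident : u ≢ proj₁ e → u ≢ proj₂ e → weight ℓ u e ≡ 0
    weight-nonincident u≢₁ u≢₂ with _≟V_ G u (proj₁ e) | _≟V_ G u (proj₂ e)
    ... | yes u≡ | _      = ⊥-elim (u≢₁ u≡)
    ... | no _   | yes u≡ = ⊥-elim (u≢₂ u≡)
    ... | no _   | no _   = refl

  module _ (ℓ : V G × V G → ℕ) (ℓ↭ : map ℓ (edges G) ↭ upTo (m G)) where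

    open Relabeling (edges G) ℓ ℓ↭

    labelingOf : Labeling G
    labelingOf = relabel , relabel-injective , relabel-surjective

    ω-labelingOf : ∀ u → ω G labelingOf u ≡ sum (map (weight ℓ u) (edges G))
    ω-labelingOf u = cong sum (begin
      map (λ t → if incident G u t then label G labelingOf t else 0) (allFin (m G))
        ≡⟨ map-cong (λ t → cong (λ l → if incident G u t then suc l else 0) (toℕ-relabel t)) (allFin (m G)) ⟩
      map (weight ℓ u ∘ lookup (edges G)) (tabulate id)
        ≡⟨ map-tabulate id (weight ℓ u ∘ lookup (edges G)) ⟩
      tabulate (weight ℓ u ∘ lookup (edges G))
        ≡⟨ map-tabulate (lookup (edges G)) (weight ℓ u) ⟨
      map (weight ℓ u) (tabulate (lookup (edges G)))
        ≡⟨ cong (map (weight ℓ u)) (tabulate-lookup (edges G)) ⟩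
      map (weight ℓ u) (edges G) ∎)
      where open ≡-Reasoning

  module _ (f : Labeling G) where

    numColors≤ : ∀ cs → (∀ u → ω G f u ∈ cs) → numColors G f ≤ length cs
    numColors≤ cs ω∈cs = Unique⇒length≤ (deduplicate-! _≟_ (map (ω G f) (vertices G))) color∈cs
      where
      color∈cs : deduplicate _≟_ (map (ω G f) (vertices G)) ⊆ cs
      color∈cs c∈ with ∈-map⁻ (ω G f) (∈-deduplicate⁻ _≟_ (map (ω G f) (vertices G)) c∈)
      ... | u , _ , refl = ω∈cs u

    adjacent⇒ω≢ : IsLocalAntimagic G f → ∀ {x y} → (x , y) ∈ edges G → ω G f x ≢ ω G f y
    adjacent⇒ω≢ antimagic xy∈ =
      subst (λ e → ω G f (proj₁ e) ≢ ω G f (proj₂ e)) (sym (lookup-index xy∈)) (antimagic (index xy∈))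

    triangle⇒3≤numColors : IsLocalAntimagic G f → ∀ {x y z} →
                           x ∈ vertices G → y ∈ vertices G → z ∈ vertices G →
                           (x , y) ∈ edges G → (x , z) ∈ edges G → (y , z) ∈ edges G →
                           3 ≤ numColors G f
    triangle⇒3≤numColors antimagic {x} {y} {z} x∈ y∈ z∈ xy xz yz = Unique⇒length≤ distinct colors⊆
      where
      distinct : Unique (ω G f x ∷ ω G f y ∷ ω G f z ∷ [])
      distinct = (adjacent⇒ω≢ antimagic xy ∷ adjacent⇒ω≢ antimagic xz ∷ [])
               ∷ (adjacent⇒ω≢ antimagic yz ∷ []) ∷ [] ∷ []
      color : ∀ {w} → w ∈ vertices G → ω G f w ∈ deduplicate _≟_ (map (ω G f) (vertices G))
      color w∈ = ∈-deduplicate⁺ _≟_ (∈-map⁺ (ω G f) w∈)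
      colors⊆ : (ω G f x ∷ ω G f y ∷ ω G f z ∷ []) ⊆ deduplicate _≟_ (map (ω G f) (vertices G))
      colors⊆ (here refl)                 = color x∈
      colors⊆ (there (here refl))         = color y∈
      colors⊆ (there (there (here refl))) = color z∈

-- The edge-corona S_k ◇ K̄_r

-- cv i, cu i y and vu i y are the labels, minus one, of the edges c v_i, c u_i^y and v_i u_i^y.
labelList : (k r : ℕ) (cv : ℕ → ℕ) (cu vu : ℕ → ℕ → ℕ) → List ℕ
labelList k r cv cu vu = applyUpTo cv k ++ concatMap (λ i → concatMap (λ y → cu i y ∷ vu i y ∷ []) (upTo r)) (upTo k)

module StarCorona (k r : ℕ) where

  G : Graph
  G = Star k ◇ Empty r

  center : V G
  center = inj₁ zero

  leaf : Fin k → V G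
  leaf j = inj₁ (suc j)

  copy : Fin (m (Star k)) → Fin r → V G
  copy i y = inj₂ (i , y)

  m-Star : m (Star k) ≡ k
  m-Star = trans (length-map _ (allFin k)) (length-tabulate id)

  leafOf : Fin (m (Star k)) → Fin k
  leafOf = cast m-Star

  spokeOf : Fin k → Fin (m (Star k))
  spokeOf = cast (sym m-Star)

  leafOf-spokeOf : ∀ j → leafOf (spokeOf j) ≡ j
  leafOf-spokeOf = cast-involutive m-Star (sym m-Star)

  spokeOf-leafOf : ∀ i → spokeOf (leafOf i) ≡ i
  spokeOf-leafOf = cast-involutive (sym m-Star) m-Star

  edge-Star : ∀ i → edge (Star k) i ≡ (zero , suc (leafOf i))
  edge-Star = lookup-map-tabulate (λ j → zero , suc j) id

  copyEdges : Fin (m (Star k)) → Fin r → List (V G × V G)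
  copyEdges i y = (center , copy i y) ∷ (leaf (leafOf i) , copy i y) ∷ []

  edges-corona : edges G ≡ map (λ j → center , leaf j) (allFin k)
                           ++ concatMap (λ i → concatMap (copyEdges i) (allFin r)) (allFin (m (Star k)))
  edges-corona = cong₂ _++_ (sym (map-∘ (allFin k)))
    (concatMap-cong (λ i → concatMap-cong (λ y → cong (λ e → (inj₁ (proj₁ e) , copy i y) ∷ (inj₁ (proj₂ e) , copy i y) ∷ [])
                                                      (edge-Star i))
                                          (allFin r))
                    (allFin (m (Star k))))

  data EdgeShape : V G × V G → Set where
    spoke       : ∀ j → EdgeShape (center , leaf j)
    center-copy : ∀ i y → EdgeShape (center , copy i y)
    leaf-copy   : ∀ j i y → EdgeShape (leaf j , copy i y)

  edge-shape : ∀ t → EdgeShape (edge G t)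
  edge-shape t = All.lookup shapes (∈-lookup t)
    where
    shapes : All EdgeShape (edges G)
    shapes = subst (All EdgeShape) (sym edges-corona) (All.++⁺
      (All.map⁺ (universal spoke (allFin k)))
      (All.concat⁺ (All.map⁺ (universal (λ i →
        All.concat⁺ (All.map⁺ (universal (λ y → center-copy i y ∷ leaf-copy (leafOf i) i y ∷ []) (allFin r))))
        (allFin (m (Star k)))))))

  module Labelled (cv : ℕ → ℕ) (cu vu : ℕ → ℕ → ℕ) where

    edgeLabel : V G × V G → ℕ
    edgeLabel (inj₁ _       , inj₁ (suc j))  = cv (toℕ j)
    edgeLabel (inj₁ zero    , inj₂ (i , y)) = cu (toℕ i) (toℕ y)
    edgeLabel (inj₁ (suc _) , inj₂ (i , y)) = vu (toℕ i) (toℕ y)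
    edgeLabel _                              = 0

    map-edgeLabel : map edgeLabel (edges G) ≡ labelList k r cv cu vu
    map-edgeLabel = begin
      map edgeLabel (edges G)                                     ≡⟨ cong (map edgeLabel) edges-corona ⟩
      map edgeLabel (spokes ++ copies)                            ≡⟨ map-++ edgeLabel spokes copies ⟩
      map edgeLabel spokes ++ map edgeLabel copies                ≡⟨ cong₂ _++_ spokeLabels copyLabels ⟩
      applyUpTo cv k ++ concatMap pairLabels (upTo (m (Star k)))  ≡⟨ cong (λ n → applyUpTo cv k ++ concatMap pairLabels (upTo n))
                                                                          m-Star ⟩
      labelList k r cv cu vu                                      ∎
      where
      open ≡-Reasoning
      spokes = map (λ j → center , leaf j) (allFin k)
      copies = concatMap (λ i → concatMap (copyEdges i) (allFin r)) (allFin (m (Star k)))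
      pairLabels : ℕ → List ℕ
      pairLabels i = concatMap (λ y → cu i y ∷ vu i y ∷ []) (upTo r)
      spokeLabels : map edgeLabel spokes ≡ applyUpTo cv k
      spokeLabels = trans (sym (map-∘ (allFin k))) (map-toℕ-allFin k cv)
      copyLabels : map edgeLabel copies ≡ concatMap pairLabels (upTo (m (Star k)))
      copyLabels = begin
        map edgeLabel copies
          ≡⟨ map-concatMap edgeLabel (λ i → concatMap (copyEdges i) (allFin r)) (allFin (m (Star k))) ⟩
        concatMap (λ i → map edgeLabel (concatMap (copyEdges i) (allFin r))) (allFin (m (Star k)))
          ≡⟨ concatMap-cong (λ i → trans (map-concatMap edgeLabel (copyEdges i) (allFin r))
                                          (concatMap-toℕ-allFin r (λ y → cu (toℕ i) y ∷ vu (toℕ i) y ∷ [])))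
                            (allFin (m (Star k))) ⟩
        concatMap (pairLabels ∘ toℕ) (allFin (m (Star k)))
          ≡⟨ concatMap-toℕ-allFin (m (Star k)) pairLabels ⟩
        concatMap pairLabels (upTo (m (Star k))) ∎

    vertexSum : V G → ℕ
    vertexSum u = sum (map (weight G edgeLabel u) (edges G))

    vertexSum-split : ∀ u → vertexSum u ≡
        sum (map (λ j → weight G edgeLabel u (center , leaf j)) (allFin k))
      + sum (map (λ i → sum (map (λ y → weight G edgeLabel u (center , copy i y)
                                       + weight G edgeLabel u (leaf (leafOf i) , copy i y)) (allFin r)))
                 (allFin (m (Star k))))
    vertexSum-split u = begin
      sum (map w (edges G))                    ≡⟨ cong (sum ∘ map w) edges-corona ⟩
      sum (map w (spokes ++ copies))           ≡⟨ cong sum (map-++ w spokes copies) ⟩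
      sum (map w spokes ++ map w copies)       ≡⟨ sum-++ (map w spokes) (map w copies) ⟩
      sum (map w spokes) + sum (map w copies)  ≡⟨ cong₂ _+_ (cong sum (sym (map-∘ (allFin k)))) copies-sum ⟩
      _                                        ∎
      where
      open ≡-Reasoning
      w = weight G edgeLabel u
      spokes = map (λ j → center , leaf j) (allFin k)
      copies = concatMap (λ i → concatMap (copyEdges i) (allFin r)) (allFin (m (Star k)))
      copies-sum = trans (sum-map-concatMap w (λ i → concatMap (copyEdges i) (allFin r)) (allFin (m (Star k))))
                         (cong sum (map-cong (λ i → sum-map-pairs w (λ y → center , copy i y)
                                                                    (λ y → leaf (leafOf i) , copy i y) (allFin r))
                                             (allFin (m (Star k)))))

    vertexSum-center : vertexSum center ≡ ∑[ j < k ] suc (cv j) + ∑[ i < k ] ∑[ y < r ] suc (cu i y)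
    vertexSum-center = begin
      vertexSum center
        ≡⟨ vertexSum-split center ⟩
      sum (map (λ j → suc (cv (toℕ j))) (allFin k))
        + sum (map (λ i → sum (map (λ y → suc (cu (toℕ i) (toℕ y)) + 0) (allFin r))) (allFin (m (Star k))))
        ≡⟨ cong₂ _+_ (sum-map-toℕ-allFin k (suc ∘ cv)) (cong sum (map-cong copies-sum (allFin (m (Star k))))) ⟩
      ∑[ j < k ] suc (cv j) + sum (map (λ i → ∑[ y < r ] suc (cu (toℕ i) y)) (allFin (m (Star k))))
        ≡⟨ cong (∑[ j < k ] suc (cv j) +_) (sum-map-toℕ-allFin (m (Star k)) (λ i → ∑[ y < r ] suc (cu i y))) ⟩
      ∑[ j < k ] suc (cv j) + ∑[ i < m (Star k) ] ∑[ y < r ] suc (cu i y)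
        ≡⟨ cong (λ n → ∑[ j < k ] suc (cv j) + ∑[ i < n ] ∑[ y < r ] suc (cu i y)) m-Star ⟩
      ∑[ j < k ] suc (cv j) + ∑[ i < k ] ∑[ y < r ] suc (cu i y) ∎
      where
      open ≡-Reasoning
      copies-sum : ∀ i → sum (map (λ y → suc (cu (toℕ i) (toℕ y)) + 0) (allFin r)) ≡ ∑[ y < r ] suc (cu (toℕ i) y)
      copies-sum i = trans (cong sum (map-cong (λ y → +-identityʳ _) (allFin r)))
                           (sum-map-toℕ-allFin r (λ y → suc (cu (toℕ i) y)))

    vertexSum-leaf : ∀ j → vertexSum (leaf j) ≡ suc (cv (toℕ j)) + ∑[ y < r ] suc (vu (toℕ j) y)
    vertexSum-leaf j = begin
      vertexSum (leaf j)
        ≡⟨ vertexSum-split (leaf j) ⟩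
      sum (map (λ j′ → w (center , leaf j′)) (allFin k))
        + sum (map (λ i → sum (map (λ y → w (leaf (leafOf i) , copy i y)) (allFin r))) (allFin (m (Star k))))
        ≡⟨ cong₂ _+_ (sum-map-allFin-single _ j other-spokes≡0)
                     (sum-map-allFin-single _ (spokeOf j) other-copies≡0) ⟩
      w (center , leaf j) + sum (map (λ y → w (leaf (leafOf (spokeOf j)) , copy (spokeOf j) y)) (allFin r))
        ≡⟨ cong₂ _+_ (weight-snd G edgeLabel {e = center , leaf j} refl) (cong sum (map-cong copy-edge (allFin r))) ⟩
      suc (cv (toℕ j)) + sum (map (λ y → suc (vu (toℕ (spokeOf j)) (toℕ y))) (allFin r))
        ≡⟨ cong (suc (cv (toℕ j)) +_) (sum-map-toℕ-allFin r (λ y → suc (vu (toℕ (spokeOf j)) y))) ⟩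
      suc (cv (toℕ j)) + ∑[ y < r ] suc (vu (toℕ (spokeOf j)) y)
        ≡⟨ cong (λ i → suc (cv (toℕ j)) + ∑[ y < r ] suc (vu i y)) (toℕ-cast (sym m-Star) j) ⟩
      suc (cv (toℕ j)) + ∑[ y < r ] suc (vu (toℕ j) y) ∎
      where
      open ≡-Reasoning
      w = weight G edgeLabel (leaf j)
      leaf-injective : ∀ {j′} → leaf j ≡ leaf j′ → j ≡ j′
      leaf-injective eq = Fin-suc-injective (inj₁-injective eq)
      other-spokes≡0 : ∀ j′ → j′ ≢ j → w (center , leaf j′) ≡ 0
      other-spokes≡0 j′ j′≢j = weight-nonincident G edgeLabel (λ ()) (λ eq → j′≢j (sym (leaf-injective eq)))
      other-copies≡0 : ∀ i → i ≢ spokeOf j → sum (map (λ y → w (leaf (leafOf i) , copy i y)) (allFin r)) ≡ 0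
      other-copies≡0 i i≢ = sum-map-zero (allFin r) (λ y → weight-nonincident G edgeLabel
        (λ eq → i≢ (trans (sym (spokeOf-leafOf i)) (cong spokeOf (sym (leaf-injective eq))))) (λ ()))
      copy-edge : ∀ y → w (leaf (leafOf (spokeOf j)) , copy (spokeOf j) y) ≡ suc (vu (toℕ (spokeOf j)) (toℕ y))
      copy-edge y = weight-fst G edgeLabel (cong leaf (sym (leafOf-spokeOf j)))

    vertexSum-copy : ∀ i y → vertexSum (copy i y) ≡ suc (cu (toℕ i) (toℕ y)) + suc (vu (toℕ i) (toℕ y))
    vertexSum-copy i y = begin
      vertexSum (copy i y)
        ≡⟨ vertexSum-split (copy i y) ⟩
      sum (map (λ _ → 0) (allFin k)) + sum (map (λ i′ → sum (map (pair i′) (allFin r))) (allFin (m (Star k))))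
        ≡⟨ cong₂ _+_ (sum-map-zero (allFin k) (λ _ → refl)) (sum-map-allFin-single _ i other-blocks≡0) ⟩
      sum (map (pair i) (allFin r))
        ≡⟨ sum-map-allFin-single (pair i) y other-copies≡0 ⟩
      pair i y
        ≡⟨ cong₂ _+_ (weight-snd G edgeLabel {e = center , copy i y} refl)
                     (weight-snd G edgeLabel {e = leaf (leafOf i) , copy i y} refl) ⟩
      suc (cu (toℕ i) (toℕ y)) + suc (vu (toℕ i) (toℕ y)) ∎
      where
      open ≡-Reasoning
      w = weight G edgeLabel (copy i y)
      pair : Fin (m (Star k)) → Fin r → ℕ
      pair i′ y′ = w (center , copy i′ y′) + w (leaf (leafOf i′) , copy i′ y′)
      pair≡0 : ∀ {i′ y′} → copy i y ≢ copy i′ y′ → pair i′ y′ ≡ 0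
      pair≡0 {i′} {y′} ≢copy = cong₂ _+_
        (weight-nonincident G edgeLabel {e = center , copy i′ y′} (λ ()) ≢copy)
        (weight-nonincident G edgeLabel {e = leaf (leafOf i′) , copy i′ y′} (λ ()) ≢copy)
      other-blocks≡0 : ∀ i′ → i′ ≢ i → sum (map (pair i′) (allFin r)) ≡ 0
      other-blocks≡0 i′ i′≢i = sum-map-zero (allFin r) λ y′ → pair≡0 (λ eq → i′≢i (sym (cong proj₁ (inj₂-injective eq))))
      other-copies≡0 : ∀ y′ → y′ ≢ y → pair i y′ ≡ 0
      other-copies≡0 y′ y′≢y = pair≡0 (λ eq → y′≢y (sym (cong proj₂ (inj₂-injective eq))))

record ThreeSumScheme (k r : ℕ) : Set where
  field
    cv : ℕ → ℕ
    cu vu : ℕ → ℕ → ℕ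
    size : ℕ
    labels↭ : labelList k r cv cu vu ↭ upTo size
    copySum leafSum : ℕ
    copy-sum : ∀ {i y} → i < k → y < r → suc (cu i y) + suc (vu i y) ≡ copySum
    leaf-sum : ∀ {i} → i < k → suc (cv i) + ∑[ y < r ] suc (vu i y) ≡ leafSum
    vu₀<cu₀ : ∀ {y} → y < r → vu 0 y < cu 0 y
    cu₀₀<cv₀ : cu 0 0 < cv 0

module ThreeSumOrder {k r : ℕ} (L : ThreeSumScheme (suc k) (suc r)) where

  open ThreeSumScheme L

  centerSum : ℕ
  centerSum = ∑[ j < suc k ] suc (cv j) + ∑[ i < suc k ] ∑[ y < suc r ] suc (cu i y)

  first-leaf≤centerSum : suc (cv 0) + ∑[ y < suc r ] suc (cu 0 y) ≤ centerSum
  first-leaf≤centerSum = +-mono-≤ (m≤m+n (suc (cv 0)) (∑[ j < k ] suc (cv (suc j))))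
                                  (m≤m+n (∑[ y < suc r ] suc (cu 0 y)) (∑[ i < k ] ∑[ y < suc r ] suc (cu (suc i) y)))

  leafSum<centerSum : leafSum < centerSum
  leafSum<centerSum = begin-strict
    leafSum                                  ≡⟨ leaf-sum z<s ⟨
    suc (cv 0) + ∑[ y < suc r ] suc (vu 0 y) <⟨ +-monoʳ-< (suc (cv 0)) (∑-mono-< r (s<s ∘ vu₀<cu₀)) ⟩
    suc (cv 0) + ∑[ y < suc r ] suc (cu 0 y) ≤⟨ first-leaf≤centerSum ⟩
    centerSum                                ∎
    where open ≤-Reasoning

  copySum<leafSum : copySum < leafSum
  copySum<leafSum = begin-strict
    copySum                                  ≡⟨ copy-sum z<s z<s ⟨
    suc (cu 0 0) + suc (vu 0 0)              <⟨ +-monoˡ-< (suc (vu 0 0)) (s<s cu₀₀<cv₀) ⟩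
    suc (cv 0) + suc (vu 0 0)                ≤⟨ +-monoʳ-≤ (suc (cv 0)) (m≤m+n _ _) ⟩
    suc (cv 0) + ∑[ y < suc r ] suc (vu 0 y) ≡⟨ leaf-sum z<s ⟩
    leafSum                                  ∎
    where open ≤-Reasoning

  copySum<centerSum : copySum < centerSum
  copySum<centerSum = begin-strict
    copySum                                  ≡⟨ copy-sum z<s z<s ⟨
    suc (cu 0 0) + suc (vu 0 0)              ≡⟨ +-comm (suc (cu 0 0)) (suc (vu 0 0)) ⟩
    suc (vu 0 0) + suc (cu 0 0)              <⟨ +-monoˡ-< (suc (cu 0 0)) (s<s (<-trans (vu₀<cu₀ z<s) cu₀₀<cv₀)) ⟩
    suc (cv 0) + suc (cu 0 0)                ≤⟨ +-monoʳ-≤ (suc (cv 0)) (m≤m+n _ _) ⟩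
    suc (cv 0) + ∑[ y < suc r ] suc (cu 0 y) ≤⟨ first-leaf≤centerSum ⟩
    centerSum                                ∎
    where open ≤-Reasoning

module _ (k r : ℕ) where

  open StarCorona (suc k) (suc r)

  3≤numColors : ∀ f → IsLocalAntimagic G f → 3 ≤ numColors G f
  3≤numColors f antimagic = triangle⇒3≤numColors G f antimagic {center} {leaf zero} {copy zero zero}
    (here refl) (there (here refl)) (∈-++⁺ʳ (map inj₁ (vertices (Star (suc k)))) (here refl))
    (here refl) (∈-++⁺ʳ spokes (here refl)) (∈-++⁺ʳ spokes (there (here refl)))
    where
    spokes = map (λ e → inj₁ (proj₁ e) , inj₁ (proj₂ e)) (edges (Star (suc k)))

  ThreeSumScheme⇒χla≡3 : ThreeSumScheme (suc k) (suc r) → χla≡ G 3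
  ThreeSumScheme⇒χla≡3 L =
    (f , antimagic , ≤-antisym (numColors≤ G f palette ω∈palette) (3≤numColors f antimagic)) , 3≤numColors
    where
    open ThreeSumScheme L
    open ThreeSumOrder L
    open Labelled cv cu vu

    ℓ↭ : map edgeLabel (edges G) ↭ upTo (m G)
    ℓ↭ = begin
      map edgeLabel (edges G)             ≡⟨ map-edgeLabel ⟩
      labelList (suc k) (suc r) cv cu vu  ↭⟨ labels↭ ⟩
      upTo size                           ≡⟨ cong upTo size≡m ⟩
      upTo (m G)                          ∎
      where
      open PermutationReasoning
      size≡m : size ≡ m G
      size≡m = trans (sym (length-upTo size)) (trans (sym (↭-length labels↭))
                 (trans (cong length (sym map-edgeLabel)) (length-map edgeLabel (edges G))))

    f : Labeling G
    f = labelingOf G edgeLabel ℓ↭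

    color : V G → ℕ
    color (inj₁ zero)    = centerSum
    color (inj₁ (suc _)) = leafSum
    color (inj₂ _)       = copySum

    ω≡color : ∀ u → ω G f u ≡ color u
    ω≡color (inj₁ zero)    = trans (ω-labelingOf G edgeLabel ℓ↭ center) vertexSum-center
    ω≡color (inj₁ (suc j)) = trans (ω-labelingOf G edgeLabel ℓ↭ (leaf j))
                                (trans (vertexSum-leaf j) (leaf-sum (toℕ<n j)))
    ω≡color (inj₂ (i , y)) = trans (ω-labelingOf G edgeLabel ℓ↭ (copy i y))
                                (trans (vertexSum-copy i y) (copy-sum (subst (toℕ i <_) m-Star (toℕ<n i)) (toℕ<n y)))

    palette : List ℕ
    palette = centerSum ∷ leafSum ∷ copySum ∷ []

    ω∈palette : ∀ u → ω G f u ∈ palette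
    ω∈palette (inj₁ zero)    = here (ω≡color (inj₁ zero))
    ω∈palette (inj₁ (suc j)) = there (here (ω≡color (inj₁ (suc j))))
    ω∈palette (inj₂ iy)      = there (there (here (ω≡color (inj₂ iy))))

    shape-colors : ∀ {e} → EdgeShape e → color (proj₁ e) ≢ color (proj₂ e)
    shape-colors (spoke _)         = >⇒≢ leafSum<centerSum
    shape-colors (center-copy _ _) = >⇒≢ copySum<centerSum
    shape-colors (leaf-copy _ _ _) = >⇒≢ copySum<leafSum

    antimagic : IsLocalAntimagic G f
    antimagic t ω≡ = shape-colors (edge-shape t)
      (trans (sym (ω≡color (proj₁ (edge G t)))) (trans ω≡ (ω≡color (proj₂ (edge G t)))))

-- Explicit labelings

rowMajor : (k r : ℕ) → (ℕ → ℕ → ℕ) → List ℕ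
rowMajor k r vu = concatMap (λ y → applyUpTo (λ i → vu i y) k) (upTo r)

-- The label of c u_i^y mirrors that of v_i u_i^y inside [0, 2 half), so all copy vertices get the same sum;
-- the spokes take the labels from 2 half on.
record MirrorScheme (k r : ℕ) : Set where
  field
    half : ℕ
    vu : ℕ → ℕ → ℕ
    offset : ℕ → ℕ
    rows↭ : rowMajor k r vu ++ map (mirror (half + half)) (rowMajor k r vu) ↭ upTo (half + half)
    offset↭ : applyUpTo offset k ↭ upTo k
    vu₀<half : ∀ {y} → y < r → vu 0 y < half
    leafSum : ℕ
    leaf-sum : ∀ {i} → i < k → suc (half + half + offset i) + ∑[ y < r ] suc (vu i y) ≡ leafSum

MirrorScheme⇒ThreeSumScheme : ∀ {k r} → MirrorScheme k (suc r) → ThreeSumScheme k (suc r)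
MirrorScheme⇒ThreeSumScheme {k} {r} S = record
  { cv = cv ; cu = cu ; vu = vu ; size = n + k ; labels↭ = labels↭
  ; copySum = suc n ; leafSum = leafSum
  ; copy-sum = λ i<k y<r → suc-mirror+suc (vu<n i<k y<r) ; leaf-sum = leaf-sum
  ; vu₀<cu₀ = <-mirror-double ∘ vu₀<half
  ; cu₀₀<cv₀ = <-≤-trans (mirror< (<-≤-trans (vu₀<half z<s) (m≤m+n half half))) (m≤m+n n (offset 0))
  }
  where
  open MirrorScheme S
  open PermutationReasoning

  n : ℕ
  n = half + half

  cv : ℕ → ℕ
  cv i = n + offset i

  cu : ℕ → ℕ → ℕ
  cu i y = mirror n (vu i y)

  vu<n : ∀ {i y} → i < k → y < suc r → vu i y < n
  vu<n {i} {y} i<k y<r = ∈-upTo⁻ (∈-resp-↭ rows↭ (∈-++⁺ˡ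
    (∈-concat⁺′ (∈-applyUpTo⁺ (λ i → vu i y) i<k) (∈-map⁺ (λ y → applyUpTo (λ i → vu i y) k) (∈-upTo⁺ y<r)))))

  columns : List ℕ
  columns = concatMap (λ i → map (vu i) (upTo (suc r))) (upTo k)

  columns↭rows : columns ↭ rowMajor k (suc r) vu
  columns↭rows = begin
    columns
      ↭⟨ concatMap-transpose↭ vu (upTo k) (upTo (suc r)) ⟩
    concatMap (λ y → map (λ i → vu i y) (upTo k)) (upTo (suc r))
      ≡⟨ concatMap-cong (λ y → map-upTo (λ i → vu i y) k) (upTo (suc r)) ⟩
    rowMajor k (suc r) vu ∎

  copyLabels↭ : concatMap (λ i → concatMap (λ y → cu i y ∷ vu i y ∷ []) (upTo (suc r))) (upTo k) ↭ upTo n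
  copyLabels↭ = begin
    concatMap (λ i → concatMap (λ y → cu i y ∷ vu i y ∷ []) (upTo (suc r))) (upTo k)
      ≡⟨ concatMap-cong (λ i → sym (concatMap-map (λ x → mirror n x ∷ x ∷ []) (vu i) (upTo (suc r)))) (upTo k) ⟩
    concatMap (λ i → concatMap (λ x → mirror n x ∷ x ∷ []) (map (vu i) (upTo (suc r)))) (upTo k)
      ≡⟨ concatMap-concatMap (λ x → mirror n x ∷ x ∷ []) (λ i → map (vu i) (upTo (suc r))) (upTo k) ⟨
    concatMap (λ x → mirror n x ∷ x ∷ []) columns
      ↭⟨ concatMap-pairs↭ (mirror n) id columns ⟩
    map (mirror n) columns ++ map id columns
      ≡⟨ cong (map (mirror n) columns ++_) (map-id columns) ⟩
    map (mirror n) columns ++ columns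
      ↭⟨ ++-↭ (map-↭ (mirror n) columns↭rows) columns↭rows ⟩
    map (mirror n) (rowMajor k (suc r) vu) ++ rowMajor k (suc r) vu
      ↭⟨ ++-comm (map (mirror n) (rowMajor k (suc r) vu)) (rowMajor k (suc r) vu) ⟩
    rowMajor k (suc r) vu ++ map (mirror n) (rowMajor k (suc r) vu)
      ↭⟨ rows↭ ⟩
    upTo n ∎

  spokeLabels↭ : applyUpTo cv k ↭ applyUpTo (n +_) k
  spokeLabels↭ = begin
    applyUpTo cv k                  ≡⟨ map-applyUpTo offset (n +_) k ⟨
    map (n +_) (applyUpTo offset k) ↭⟨ map-↭ (n +_) offset↭ ⟩
    map (n +_) (upTo k)             ≡⟨ map-upTo (n +_) k ⟩
    applyUpTo (n +_) k              ∎

  labels↭ : labelList k (suc r) cv cu vu ↭ upTo (n + k)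
  labels↭ = begin
    applyUpTo cv k ++ _          ↭⟨ ++-↭ spokeLabels↭ copyLabels↭ ⟩
    applyUpTo (n +_) k ++ upTo n ↭⟨ ++-comm (applyUpTo (n +_) k) (upTo n) ⟩
    upTo n ++ applyUpTo (n +_) k ≡⟨ applyUpTo-+ id n k ⟨
    upTo (n + k)                 ∎

double : ℕ → ℕ
double zero    = zero
double (suc t) = suc (suc (double t))

data Halving : ℕ → Set where
  even : ∀ t → Halving (double t)
  odd  : ∀ t → Halving (suc (double t))

halving : ∀ n → Halving n
halving zero = even 0
halving (suc n) with halving n
... | even t = odd t
... | odd t  = even (suc t)

module Zigzag (k : ℕ) where

  private
    K = suc k

  -- Consecutive rows run in opposite directions, so any two consecutive rows contribute k to every leaf.
  zigzag : ℕ → ℕ → ℕ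
  zigzag zero          i = mirror K i
  zigzag (suc zero)    i = i
  zigzag (suc (suc y)) i = zigzag y i

  rowLabel : ℕ → ℕ → ℕ
  rowLabel y i = y * K + zigzag y i

  i+mirror : ∀ {i} → i < K → i + mirror K i ≡ k
  i+mirror i<K = suc-injective (suc+mirror i<K)

  zigzag↭ : ∀ y (f : ℕ → ℕ) → applyUpTo (f ∘ zigzag y) K ↭ applyUpTo f K
  zigzag↭ zero          f = applyUpTo-mirror↭ f K
  zigzag↭ (suc zero)    f = ↭-refl
  zigzag↭ (suc (suc y)) f = zigzag↭ y f

  zigzag< : ∀ y {i} → i < K → zigzag y i < K
  zigzag< zero          i<K = mirror< i<K
  zigzag< (suc zero)    i<K = i<K
  zigzag< (suc (suc y)) i<K = zigzag< y i<K

  rowLabel< : ∀ {R y i} → y < R → i < K → rowLabel y i < R * K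
  rowLabel< {R} {y} {i} y<R i<K = begin-strict
    y * K + zigzag y i  <⟨ +-monoʳ-< (y * K) (zigzag< y i<K) ⟩
    y * K + K           ≡⟨ +-comm (y * K) K ⟩
    suc y * K           ≤⟨ *-monoˡ-≤ K y<R ⟩
    R * K               ∎
    where open ≤-Reasoning

  concatMap-blocks : ∀ R (f : ℕ → ℕ) →
                     concatMap (λ y → applyUpTo (λ i → f (y * K + i)) K) (upTo R) ≡ applyUpTo f (R * K)
  concatMap-blocks zero    f = refl
  concatMap-blocks (suc R) f = begin
    concatMap block (upTo (suc R))
      ≡⟨ concatMap-upTo-suc block R ⟩
    applyUpTo f K ++ concatMap (λ y → block (suc y)) (upTo R)
      ≡⟨ cong (applyUpTo f K ++_) (concatMap-cong (λ y → applyUpTo-cong K (λ {i} _ → cong f (+-assoc K (y * K) i))) (upTo R)) ⟩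
    applyUpTo f K ++ concatMap (λ y → applyUpTo (λ i → f (K + (y * K + i))) K) (upTo R)
      ≡⟨ cong (applyUpTo f K ++_) (concatMap-blocks R (λ j → f (K + j))) ⟩
    applyUpTo f K ++ applyUpTo (λ j → f (K + j)) (R * K)
      ≡⟨ applyUpTo-+ f K (R * K) ⟨
    applyUpTo f (suc R * K) ∎
    where
    open ≡-Reasoning
    block : ℕ → List ℕ
    block y = applyUpTo (λ i → f (y * K + i)) K

  rowLabels↭ : ∀ R → rowMajor K R (λ i y → rowLabel y i) ↭ upTo (R * K)
  rowLabels↭ R = begin
    concatMap (λ y → applyUpTo ((y * K +_) ∘ zigzag y) K) (upTo R)
      ↭⟨ concatMap-↭ (λ y → zigzag↭ y (y * K +_)) (upTo R) ⟩
    concatMap (λ y → applyUpTo (y * K +_) K) (upTo R)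
      ≡⟨ concatMap-blocks R id ⟩
    upTo (R * K) ∎
    where open PermutationReasoning

  ∑-zigzag : ∀ t {i} → i < K → ∑[ y < suc (double t) ] zigzag y i ≡ mirror K i + t * k
  ∑-zigzag zero    i<K = refl
  ∑-zigzag (suc t) {i} i<K = begin
    mirror K i + (i + ∑[ y < suc (double t) ] zigzag y i) ≡⟨ cong (λ s → mirror K i + (i + s)) (∑-zigzag t i<K) ⟩
    mirror K i + (i + (mirror K i + t * k))               ≡⟨ cong (mirror K i +_) (+-assoc i (mirror K i) (t * k)) ⟨
    mirror K i + (i + mirror K i + t * k)                 ≡⟨ cong (λ s → mirror K i + (s + t * k)) (i+mirror i<K) ⟩
    mirror K i + (k + t * k)                              ∎
    where open ≡-Reasoning

  ∑-rowLabel : ∀ t {i} → i < K →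
               ∑[ y < suc (double t) ] suc (rowLabel y i) ≡ ∑[ y < suc (double t) ] suc (y * K) + (mirror K i + t * k)
  ∑-rowLabel t {i} i<K = trans (∑-+ (suc (double t)) (λ y → suc (y * K)) (λ y → zigzag y i))
                               (cong (∑[ y < suc (double t) ] suc (y * K) +_) (∑-zigzag t i<K))

  oddScheme : ∀ t → MirrorScheme K (suc (double t))
  oddScheme t = record
    { half = n ; vu = λ i y → rowLabel y i ; offset = id
    ; rows↭ = rows↭ ; offset↭ = ↭-refl
    ; vu₀<half = λ y<r → rowLabel< y<r z<s
    ; leafSum = suc (n + n + k + Y + t * k) ; leaf-sum = leaf-sum
    }
    where
    r = suc (double t)
    n = r * K
    Y = ∑[ y < r ] suc (y * K)

    rows = rowMajor K r (λ i y → rowLabel y i)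

    rows↭ : rows ++ map (mirror (n + n)) rows ↭ upTo (n + n)
    rows↭ = begin
      rows ++ map (mirror (n + n)) rows       ↭⟨ ++-↭ (rowLabels↭ r) (map-↭ (mirror (n + n)) (rowLabels↭ r)) ⟩
      upTo n ++ map (mirror (n + n)) (upTo n) ↭⟨ ++⁺ˡ (upTo n) (map-mirror-upTo↭ refl) ⟩
      upTo n ++ applyUpTo (n +_) n            ≡⟨ applyUpTo-+ id n n ⟨
      upTo (n + n)                            ∎
      where open PermutationReasoning

    rearrange : ∀ N i j Y T → suc (N + i) + (Y + (j + T)) ≡ suc (N + (i + j) + Y + T)
    rearrange = solve-∀

    leaf-sum : ∀ {i} → i < K → suc (n + n + i) + ∑[ y < r ] suc (rowLabel y i) ≡ suc (n + n + k + Y + t * k)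
    leaf-sum {i} i<K = begin
      suc (n + n + i) + ∑[ y < r ] suc (rowLabel y i)  ≡⟨ cong (suc (n + n + i) +_) (∑-rowLabel t i<K) ⟩
      suc (n + n + i) + (Y + (mirror K i + t * k))     ≡⟨ rearrange (n + n) i (mirror K i) Y (t * k) ⟩
      suc (n + n + (i + mirror K i) + Y + t * k)       ≡⟨ cong (λ s → suc (n + n + s + Y + t * k)) (i+mirror i<K) ⟩
      suc (n + n + k + Y + t * k)                      ∎
      where open ≡-Reasoning

  -- The extra first row takes the even labels of the middle block [a, a + 2K) and its mirror the odd ones;
  -- it adds 2i at leaf i, which the reversed spokes and the odd number of zigzag rows cancel.
  evenScheme : ∀ t → MirrorScheme K (suc (suc (double t)))
  evenScheme t = record
    { half = n ; vu = vu ; offset = mirror K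
    ; rows↭ = rows↭ ; offset↭ = applyUpTo-mirror↭ id K
    ; vu₀<half = vu₀<n
    ; leafSum = suc (suc (n + n + a + k + k + Y + t * k)) ; leaf-sum = leaf-sum
    }
    where
    R = suc (double t)
    a = R * K
    n = K + a
    Y = ∑[ y < R ] suc (y * K)

    vu : ℕ → ℕ → ℕ
    vu i zero    = a + (i + i)
    vu i (suc y) = rowLabel y i

    window = applyUpTo (λ i → a + (i + i)) K
    zigzagRows = rowMajor K R (λ i y → rowLabel y i)

    total : a + (K + K) + a ≡ n + n
    total = rearrange-total a K
      where
      rearrange-total : ∀ a K → a + (K + K) + a ≡ K + a + (K + a)
      rearrange-total = solve-∀

    rows↭ : rowMajor K (suc R) vu ++ map (mirror (n + n)) (rowMajor K (suc R) vu) ↭ upTo (n + n)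
    rows↭ = begin
      rowMajor K (suc R) vu ++ map (mirror (n + n)) (rowMajor K (suc R) vu)
        ≡⟨ cong (λ xs → xs ++ map (mirror (n + n)) xs) (concatMap-upTo-suc (λ y → applyUpTo (λ i → vu i y) K) R) ⟩
      (window ++ zigzagRows) ++ map (mirror (n + n)) (window ++ zigzagRows)
        ≡⟨ cong ((window ++ zigzagRows) ++_) (map-++ (mirror (n + n)) window zigzagRows) ⟩
      (window ++ zigzagRows) ++ map (mirror (n + n)) window ++ map (mirror (n + n)) zigzagRows
        ≡⟨ ++-assoc window zigzagRows _ ⟩
      window ++ zigzagRows ++ map (mirror (n + n)) window ++ map (mirror (n + n)) zigzagRows
        ↭⟨ shifts window zigzagRows ⟩
      zigzagRows ++ window ++ map (mirror (n + n)) window ++ map (mirror (n + n)) zigzagRows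
        ≡⟨ cong (zigzagRows ++_) (++-assoc window _ _) ⟨
      zigzagRows ++ (window ++ map (mirror (n + n)) window) ++ map (mirror (n + n)) zigzagRows
        ↭⟨ ++-↭ (rowLabels↭ R) (++-↭ (map-mirror-window↭ a K)
                  (↭-trans (map-↭ (mirror (n + n)) (rowLabels↭ R)) (map-mirror-upTo↭ total))) ⟩
      upTo a ++ applyUpTo (a +_) (K + K) ++ applyUpTo (a + (K + K) +_) a
        ≡⟨ ++-assoc (upTo a) _ _ ⟨
      (upTo a ++ applyUpTo (a +_) (K + K)) ++ applyUpTo (a + (K + K) +_) a
        ≡⟨ cong (_++ applyUpTo (a + (K + K) +_) a) (applyUpTo-+ id a (K + K)) ⟨
      upTo (a + (K + K)) ++ applyUpTo (a + (K + K) +_) a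
        ≡⟨ applyUpTo-+ id (a + (K + K)) a ⟨
      upTo (a + (K + K) + a)
        ≡⟨ cong upTo total ⟩
      upTo (n + n) ∎
      where open PermutationReasoning

    vu₀<n : ∀ {y} → y < suc R → vu 0 y < n
    vu₀<n {zero}  _     = subst (_< n) (sym (+-identityʳ a)) (m<n+m a z<s)
    vu₀<n {suc y} y<R+1 = <-≤-trans (rowLabel< (≤-pred y<R+1) z<s) (m≤n+m a K)

    rearrange : ∀ N a i j Y T →
                suc (N + j) + (suc (a + (i + i)) + (Y + (j + T))) ≡ suc (suc (N + a + (i + j) + (i + j) + Y + T))
    rearrange = solve-∀

    leaf-sum : ∀ {i} → i < K →
               suc (n + n + mirror K i) + ∑[ y < suc R ] suc (vu i y) ≡ suc (suc (n + n + a + k + k + Y + t * k))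
    leaf-sum {i} i<K = begin
      suc (n + n + mirror K i) + (suc (a + (i + i)) + ∑[ y < R ] suc (rowLabel y i))
        ≡⟨ cong (λ s → suc (n + n + mirror K i) + (suc (a + (i + i)) + s)) (∑-rowLabel t i<K) ⟩
      suc (n + n + mirror K i) + (suc (a + (i + i)) + (Y + (mirror K i + t * k)))
        ≡⟨ rearrange (n + n) a i (mirror K i) Y (t * k) ⟩
      suc (suc (n + n + a + (i + mirror K i) + (i + mirror K i) + Y + t * k))
        ≡⟨ cong (λ s → suc (suc (n + n + a + s + s + Y + t * k))) (i+mirror i<K) ⟩
      suc (suc (n + n + a + k + k + Y + t * k)) ∎
      where open ≡-Reasoning

mainTheorem7 : (k r : ℕ) → 0 < k → 0 < r → χla≡ (Star k ◇ Empty r) 3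
mainTheorem7 (suc k) (suc r) _ _ = ThreeSumScheme⇒χla≡3 k r (MirrorScheme⇒ThreeSumScheme (scheme (halving r)))
  where
  scheme : ∀ {r} → Halving r → MirrorScheme (suc k) (suc r)
  scheme (even t) = Zigzag.oddScheme k t
  scheme (odd t)  = Zigzag.evenScheme k t
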